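{- Let $m\ge 3$ and let $F_m(\mathbf x)=a_1P_m(x_1)+\cdots+a_nP_m(x_n)$ be an $m$-gonal form with positive integer coefficients $a_1\le\cdots\le a_n$ which represents every positive integer up to $m-4$. Let $1\le i\le n$ and let $N$ be an integer. If the form $a_1P_m(x_1)+\cdots+a_iP_m(x_i)$ represents each of the $a_1+\cdots+a_i+1$ consecutive integers $N,N+1,\dots,N+(a_1+\cdots+a_i)$, then $F_m(\mathbf x)$ represents each of the $m-3$ consecutive integers $N,N+1,\dots,N+(m-4)$.
   Context: For $m\ge 3$ and $x\in\mathbb Z$, the (generalized) $m$-gonal number is $P_m(x)=\frac{m-2}{2}x^2-\frac{m-4}{2}x$. An $m$-gonal form is $F_m(\mathbf x)=a_1P_m(x_1)+\cdots+a_nP_m(x_n)$ with $a_k$ positive integers. It represents an integer $N$ if $F_m(\mathbf x)=N$ has a solution $\mathbf x\in\mathbb Z^n$. -}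

module Defs where

open import Data.Nat as ℕ using (ℕ; suc)
open import Data.Integer as ℤ using (ℤ; +_; _+_; _*_; _-_)
open import Data.Integer.DivMod using (_/_)
import Data.Fin
open import Data.Fin using (Fin; toℕ; inject≤)
open import Data.Product using (∃)
open import Relation.Binary.PropositionalEquality using (_≡_)

-- generalized m-gonal number:
-- P_m(x) = ((m-2)/2) x^2 - ((m-4)/2) x = (m-2) * (x(x-1)/2) + x
-- (x(x-1) is always even, so the division by 2 is exact).
P : ℕ → ℤ → ℤ
P m x = (+ (m ℕ.∸ 2)) * ((x * (x - + 1)) / (+ 2)) + x

Σ[<_] : (n : ℕ) → (Fin n → ℤ) → ℤ
Σ[< ℕ.zero ] f = + 0
Σ[< suc n ] f = f Data.Fin.zero + Σ[< n ] (λ k → f (Data.Fin.suc k))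

F : (m : ℕ) {n : ℕ} → (Fin n → ℕ) → (Fin n → ℤ) → ℤ
F m {n} a x = Σ[< n ] (λ k → + a k * P m (x k))

Represents : (m : ℕ) {n : ℕ} → (Fin n → ℕ) → ℤ → Set
Represents m {n} a N = ∃ λ (x : Fin n → ℤ) → F m a x ≡ N

firstCoeffs : {n : ℕ} (i : ℕ) → i ℕ.≤ n → (Fin n → ℕ) → Fin i → ℕ
firstCoeffs i i≤n a k = a (inject≤ k i≤n)

coeffSum : {i : ℕ} → (Fin i → ℕ) → ℕ
coeffSum {ℕ.zero} a = 0
coeffSum {suc i} a = a Data.Fin.zero ℕ.+ coeffSum (λ k → a (Data.Fin.suc k))

-- Since m ≥ 3, every value P_m(x) is a natural number that is either 0, 1 or at least m − 3.
-- Let T_k = a_1 + ⋯ + a_k. If the first k variables represent N, …, N + T_k and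
-- a_{k+1} ≤ T_k + 1, then setting x_{k+1} ∈ {0, 1} shows that the first k + 1 variables
-- represent N, …, N + T_{k+1}. This escalation can only stop at some k with T_k < m − 4 if
-- a_{k+1} > T_k + 1 (or k = n); but then T_k + 1 ≤ m − 4 is represented by F_m, necessarily
-- with all P_m(x_l) ∈ {0, 1} and x_l = 0 for l > k by monotonicity of the a_l, so T_k + 1 is a
-- sum of some of a_1, …, a_k, which is absurd.
module Submission where

open import Defs
open import Data.Nat as ℕ using (ℕ; _≤_; _<_; _∸_; _≰_)
open import Data.Integer as ℤ using (ℤ; +_; _+_)
open import Data.Fin using (Fin; toℕ)

open import Data.Nat using (zero; suc; z≤n; s≤s; s≤s⁻¹; _≤?_; >-nonZero)
import Data.Nat.Properties as ℕP
open import Data.Nat.DivMod using (m*n/n≡m)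
open import Data.Integer using (-[1+_]; _*_; _-_)
import Data.Integer.Properties as ℤP
open import Data.Fin using (fromℕ<) renaming (zero to fzero; suc to fsuc)
open import Data.Fin.Properties using (toℕ<n; toℕ-fromℕ<)
open import Data.Vec.Functional using (updateAt)
open import Data.Vec.Functional.Properties using (updateAt-minimal)
open import Data.Product using (∃; _,_; _×_)
open import Data.Sum using (_⊎_; inj₁; inj₂)
open import Data.Empty using (⊥-elim)
open import Function using (_∘_; const)
open import Relation.Nullary using (¬_; Dec; yes; no; contradiction)
open import Relation.Binary.PropositionalEquality
open ≡-Reasoning

triangle : ℕ → ℕ
triangle zero = 0
triangle (suc k) = k ℕ.+ triangle k

triangle-*2 : ∀ k → triangle (suc k) ℕ.* 2 ≡ suc k ℕ.* k
triangle-*2 zero = refl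
triangle-*2 (suc k) = begin
  (suc k ℕ.+ triangle (suc k)) ℕ.* 2    ≡⟨ ℕP.*-distribʳ-+ 2 (suc k) (triangle (suc k)) ⟩
  suc k ℕ.* 2 ℕ.+ triangle (suc k) ℕ.* 2 ≡⟨ cong (suc k ℕ.* 2 ℕ.+_) (triangle-*2 k) ⟩
  suc k ℕ.* 2 ℕ.+ suc k ℕ.* k           ≡⟨ ℕP.*-distribˡ-+ (suc k) 2 k ⟨
  suc k ℕ.* (2 ℕ.+ k)                   ≡⟨ ℕP.*-comm (suc k) (2 ℕ.+ k) ⟩
  (2 ℕ.+ k) ℕ.* suc k                   ∎

-- binom₂ x = x (x − 1) / 2, the generalised binomial coefficient (x choose 2)
binom₂ : ℤ → ℕ
binom₂ (+ k) = triangle k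
binom₂ -[1+ n ] = triangle (2 ℕ.+ n)

x*[x-1]≡binom₂*2 : ∀ x → x * (x - + 1) ≡ + (binom₂ x ℕ.* 2)
x*[x-1]≡binom₂*2 (+ zero) = refl
x*[x-1]≡binom₂*2 (+ suc k) = trans (sym (ℤP.pos-* (suc k) k)) (cong +_ (sym (triangle-*2 k)))
x*[x-1]≡binom₂*2 -[1+ n ] = begin
  -[1+ n ] * (-[1+ n ] - + 1)   ≡⟨ cong (λ z → -[1+ n ] * -[1+ suc z ]) (ℕP.+-identityʳ n) ⟩
  + (suc n ℕ.* (2 ℕ.+ n))       ≡⟨ cong +_ (ℕP.*-comm (suc n) (2 ℕ.+ n)) ⟩
  + ((2 ℕ.+ n) ℕ.* suc n)       ≡⟨ cong +_ (triangle-*2 (suc n)) ⟨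
  + (triangle (2 ℕ.+ n) ℕ.* 2)  ∎

P≡binom₂ : ∀ m x → P m x ≡ + (m ∸ 2) * + binom₂ x + x
P≡binom₂ m x = cong (λ z → + (m ∸ 2) * z + x) (begin
  (x * (x - + 1)) ℤ./ + 2        ≡⟨ cong (ℤ._/ + 2) (x*[x-1]≡binom₂*2 x) ⟩
  + (binom₂ x ℕ.* 2) ℤ./ + 2     ≡⟨ ℤP.*-identityˡ (+ (binom₂ x ℕ.* 2 ℕ./ 2)) ⟩
  + (binom₂ x ℕ.* 2 ℕ./ 2)       ≡⟨ cong +_ (m*n/n≡m (binom₂ x) 2) ⟩
  + binom₂ x                     ∎)

P-zero : ∀ m → P m (+ 0) ≡ + 0
P-zero m = cong (_+ + 0) (ℤP.*-zeroʳ (+ (m ∸ 2)))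

P-one : ∀ m → P m (+ 1) ≡ + 1
P-one m = cong (_+ + 1) (ℤP.*-zeroʳ (+ (m ∸ 2)))

-- P_m(x) as a natural number, for m = 3 + c
Pℕ : ℕ → ℤ → ℕ
Pℕ c (+ k) = suc c ℕ.* triangle k ℕ.+ k
Pℕ c -[1+ n ] = suc c ℕ.* triangle (2 ℕ.+ n) ∸ suc n

c+1+n≤[1+c]*triangle[2+n] : ∀ c n → c ℕ.+ suc n ≤ suc c ℕ.* triangle (2 ℕ.+ n)
c+1+n≤[1+c]*triangle[2+n] c n = ℕP.≤-trans (ℕP.≤-reflexive (ℕP.+-comm c (suc n)))
  (ℕP.+-mono-≤ (ℕP.m≤m+n (suc n) (triangle (suc n))) (ℕP.m≤m*n c (triangle (2 ℕ.+ n))))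

P≡Pℕ : ∀ c x → P (3 ℕ.+ c) x ≡ + Pℕ c x
P≡Pℕ c x@(+ k) = begin
  P (3 ℕ.+ c) x                    ≡⟨ P≡binom₂ (3 ℕ.+ c) x ⟩
  + suc c * + triangle k + + k     ≡⟨ cong (_+ + k) (ℤP.pos-* (suc c) (triangle k)) ⟨
  + (suc c ℕ.* triangle k) + + k   ≡⟨ ℤP.pos-+ (suc c ℕ.* triangle k) k ⟨
  + Pℕ c x                         ∎
P≡Pℕ c x@(-[1+ n ]) = begin
  P (3 ℕ.+ c) x                  ≡⟨ P≡binom₂ (3 ℕ.+ c) x ⟩
  + suc c * + T + -[1+ n ]       ≡⟨ cong (_+ -[1+ n ]) (ℤP.pos-* (suc c) T) ⟨
  + (suc c ℕ.* T) + -[1+ n ]     ≡⟨ ℤP.⊖-≥ (ℕP.m+n≤o⇒n≤o c (c+1+n≤[1+c]*triangle[2+n] c n)) ⟩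
  + Pℕ c x                       ∎
  where
  T : ℕ
  T = triangle (2 ℕ.+ n)

Pℕ≤1⊎c≤Pℕ : ∀ c x → Pℕ c x ≤ 1 ⊎ c ≤ Pℕ c x
Pℕ≤1⊎c≤Pℕ c (+ zero) = inj₁ (ℕP.m≤n⇒m≤1+n (ℕP.+-monoˡ-≤ 0 (ℕP.≤-reflexive (ℕP.*-zeroʳ c))))
Pℕ≤1⊎c≤Pℕ c (+ suc zero) = inj₁ (ℕP.+-monoˡ-≤ 1 (ℕP.≤-reflexive (ℕP.*-zeroʳ c)))
Pℕ≤1⊎c≤Pℕ c (+ suc (suc k)) = inj₂ (ℕP.≤-trans (ℕP.n≤1+n c)
  (ℕP.≤-trans (ℕP.m≤m*n (suc c) (triangle (2 ℕ.+ k))) (ℕP.m≤m+n _ (2 ℕ.+ k))))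
Pℕ≤1⊎c≤Pℕ c -[1+ n ] = inj₂ (ℕP.m+n≤o⇒m≤o∸n c (c+1+n≤[1+c]*triangle[2+n] c n))

Σ-cong : ∀ {n} {f g : Fin n → ℤ} → (∀ l → f l ≡ g l) → Σ[< n ] f ≡ Σ[< n ] g
Σ-cong {zero} f≗g = refl
Σ-cong {suc n} f≗g = cong₂ _+_ (f≗g fzero) (Σ-cong (f≗g ∘ fsuc))

Σ-zero : ∀ {n} {f : Fin n → ℤ} → (∀ l → f l ≡ + 0) → Σ[< n ] f ≡ + 0
Σ-zero {zero} f≗0 = refl
Σ-zero {suc n} f≗0 = cong₂ _+_ (f≗0 fzero) (Σ-zero (f≗0 ∘ fsuc))

Σ-pos : ∀ {n} (b : Fin n → ℕ) → Σ[< n ] (λ l → + b l) ≡ + coeffSum b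
Σ-pos {zero} b = refl
Σ-pos {suc n} b = trans (cong (_+_ (+ b fzero)) (Σ-pos (b ∘ fsuc))) (sym (ℤP.pos-+ (b fzero) _))

F≡coeffSum∘Pℕ : ∀ c {n} (a : Fin n → ℕ) x → F (3 ℕ.+ c) a x ≡ + coeffSum (λ l → a l ℕ.* Pℕ c (x l))
F≡coeffSum∘Pℕ c a x = trans
  (Σ-cong λ l → trans (cong (+ a l *_) (P≡Pℕ c (x l))) (sym (ℤP.pos-* (a l) (Pℕ c (x l)))))
  (Σ-pos (λ l → a l ℕ.* Pℕ c (x l)))

F-updateAt-0↦1 : ∀ m {n} (a : Fin n → ℕ) (x : Fin n → ℤ) p → x p ≡ + 0 →
                 F m a (updateAt x p (const (+ 1))) ≡ F m a x + + a p
F-updateAt-0↦1 m a x fzero x₀≡0 = begin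
  + a fzero * P m (+ 1) + S               ≡⟨ cong (λ z → + a fzero * z + S) (P-one m) ⟩
  + a fzero * + 1 + S                     ≡⟨ cong (_+ S) (ℤP.*-identityʳ (+ a fzero)) ⟩
  + a fzero + S                           ≡⟨ ℤP.+-comm (+ a fzero) S ⟩
  S + + a fzero                           ≡⟨ cong (_+ + a fzero) (ℤP.+-identityˡ S) ⟨
  + 0 + S + + a fzero                     ≡⟨ cong (λ z → z + S + + a fzero) term₀≡0 ⟨
  + a fzero * P m (x fzero) + S + + a fzero ∎
  where
  S : ℤ
  S = F m (a ∘ fsuc) (x ∘ fsuc)
  term₀≡0 : + a fzero * P m (x fzero) ≡ + 0
  term₀≡0 = trans (cong (λ z → + a fzero * P m z) x₀≡0)
                  (trans (cong (+ a fzero *_) (P-zero m)) (ℤP.*-zeroʳ (+ a fzero)))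
F-updateAt-0↦1 m a x (fsuc p) xₚ≡0 =
  trans (cong (_+_ (+ a fzero * P m (x fzero))) (F-updateAt-0↦1 m (a ∘ fsuc) (x ∘ fsuc) p xₚ≡0))
        (sym (ℤP.+-assoc (+ a fzero * P m (x fzero)) _ (+ a (fsuc p))))

-- the sum of the first min k n coefficients
prefixSum : ∀ {n} → (Fin n → ℕ) → ℕ → ℕ
prefixSum a zero = 0
prefixSum {zero} a (suc k) = 0
prefixSum {suc n} a (suc k) = a fzero ℕ.+ prefixSum (a ∘ fsuc) k

prefixSum-suc : ∀ {n} (a : Fin n → ℕ) {k} (k<n : k < n) →
                prefixSum a (suc k) ≡ prefixSum a k ℕ.+ a (fromℕ< k<n)
prefixSum-suc {suc n} a {zero} _ = ℕP.+-identityʳ (a fzero)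
prefixSum-suc {suc n} a {suc k} k<n =
  trans (cong (a fzero ℕ.+_) (prefixSum-suc (a ∘ fsuc) (ℕ.s<s⁻¹ k<n)))
        (sym (ℕP.+-assoc (a fzero) _ _))

coeffSum-firstCoeffs : ∀ {i n} (i≤n : i ≤ n) (a : Fin n → ℕ) →
                       coeffSum (firstCoeffs i i≤n a) ≡ prefixSum a i
coeffSum-firstCoeffs {zero} i≤n a = refl
coeffSum-firstCoeffs {suc i} {suc n} i≤n a = cong (a fzero ℕ.+_) (coeffSum-firstCoeffs (s≤s⁻¹ i≤n) (a ∘ fsuc))

coeff≤coeffSum : ∀ {n} (b : Fin n → ℕ) l → b l ≤ coeffSum b
coeff≤coeffSum b fzero = ℕP.m≤m+n _ _
coeff≤coeffSum b (fsuc l) = ℕP.≤-trans (coeff≤coeffSum (b ∘ fsuc) l) (ℕP.m≤n+m _ (b fzero))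

coeffSum≤prefixSum : ∀ {n} (b a : Fin n → ℕ) k → (∀ l → b l ≤ a l) → (∀ l → k ≤ toℕ l → b l ≡ 0) →
                     coeffSum b ≤ prefixSum a k
coeffSum≤prefixSum {zero} b a k b≤a b≡0 = z≤n
coeffSum≤prefixSum {suc n} b a zero b≤a b≡0 =
  ℕP.+-mono-≤ (ℕP.≤-reflexive (b≡0 fzero z≤n))
    (coeffSum≤prefixSum (b ∘ fsuc) (a ∘ fsuc) zero (b≤a ∘ fsuc) (λ l _ → b≡0 (fsuc l) z≤n))
coeffSum≤prefixSum {suc n} b a (suc k) b≤a b≡0 =
  ℕP.+-mono-≤ (b≤a fzero)
    (coeffSum≤prefixSum (b ∘ fsuc) (a ∘ fsuc) k (b≤a ∘ fsuc) (λ l k≤l → b≡0 (fsuc l) (s≤s k≤l)))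

m*n<m⇒m*n≡0 : ∀ m n → m ℕ.* n < m → m ℕ.* n ≡ 0
m*n<m⇒m*n≡0 m zero _ = ℕP.*-zeroʳ m
m*n<m⇒m*n≡0 m (suc n) mn<m = contradiction (ℕP.m≤m*n m (suc n)) (ℕP.<⇒≱ mn<m)

VanishesFrom : ∀ {n} → ℕ → (Fin n → ℤ) → Set
VanishesFrom k x = ∀ l → k ≤ toℕ l → x l ≡ + 0

extendByZero : ∀ {i n} → i ≤ n → (Fin i → ℤ) → Fin n → ℤ
extendByZero {zero} _ y _ = + 0
extendByZero {suc i} {suc n} i≤n y fzero = y fzero
extendByZero {suc i} {suc n} i≤n y (fsuc l) = extendByZero (s≤s⁻¹ i≤n) (y ∘ fsuc) l

extendByZero-vanishes : ∀ {i n} (i≤n : i ≤ n) y → VanishesFrom i (extendByZero i≤n y)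
extendByZero-vanishes {zero} i≤n y l _ = refl
extendByZero-vanishes {suc i} {suc n} i≤n y (fsuc l) i≤l =
  extendByZero-vanishes (s≤s⁻¹ i≤n) (y ∘ fsuc) l (s≤s⁻¹ i≤l)

F-extendByZero : ∀ m {i n} (i≤n : i ≤ n) (a : Fin n → ℕ) y →
                 F m a (extendByZero i≤n y) ≡ F m (firstCoeffs i i≤n a) y
F-extendByZero m {zero} i≤n a y =
  Σ-zero λ l → trans (cong (+ a l *_) (P-zero m)) (ℤP.*-zeroʳ (+ a l))
F-extendByZero m {suc i} {suc n} i≤n a y =
  cong (_+_ (+ a fzero * P m (y fzero))) (F-extendByZero m (s≤s⁻¹ i≤n) (a ∘ fsuc) (y ∘ fsuc))

-- In a representation of t < m − 3 every P_m(x_l) is 0 or 1, and it is 0 wherever a_l > t.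
small-value≤prefixSum : ∀ c {n} (a : Fin n → ℕ) → (∀ l → 0 < a l) → ∀ x {t k} →
                        F (3 ℕ.+ c) a x ≡ + t → t < c → (∀ l → k ≤ toℕ l → t < a l) →
                        t ≤ prefixSum a k
small-value≤prefixSum c {n} a pos x {t} {k} Fx≡t t<c later>t =
  ℕP.≤-trans (ℕP.≤-reflexive (sym Σb≡t)) (coeffSum≤prefixSum b a k b≤a b≡0)
  where
  b : Fin n → ℕ
  b l = a l ℕ.* Pℕ c (x l)
  Σb≡t : coeffSum b ≡ t
  Σb≡t = ℤP.+-injective (trans (sym (F≡coeffSum∘Pℕ c a x)) Fx≡t)
  b≤t : ∀ l → b l ≤ t
  b≤t l = ℕP.≤-trans (coeff≤coeffSum b l) (ℕP.≤-reflexive Σb≡t)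
  Pℕ≤1 : ∀ l → Pℕ c (x l) ≤ 1
  Pℕ≤1 l with Pℕ≤1⊎c≤Pℕ c (x l)
  ... | inj₁ Pℕ≤1 = Pℕ≤1
  ... | inj₂ c≤Pℕ = contradiction
    (ℕP.≤-trans c≤Pℕ (ℕP.≤-trans (ℕP.m≤n*m _ (a l) {{>-nonZero (pos l)}}) (b≤t l))) (ℕP.<⇒≱ t<c)
  b≤a : ∀ l → b l ≤ a l
  b≤a l = ℕP.≤-trans (ℕP.*-monoʳ-≤ (a l) (Pℕ≤1 l)) (ℕP.≤-reflexive (ℕP.*-identityʳ (a l)))
  b≡0 : ∀ l → k ≤ toℕ l → b l ≡ 0
  b≡0 l k≤l = m*n<m⇒m*n≡0 (a l) _ (ℕP.≤-<-trans (b≤t l) (later>t l k≤l))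

t+4≤3+c⇒t<c : ∀ {t c} → t ℕ.+ 4 ≤ 3 ℕ.+ c → t < c
t+4≤3+c⇒t<c {t} {c} t+4≤3+c = s≤s⁻¹ (s≤s⁻¹ (s≤s⁻¹ (subst (_≤ 3 ℕ.+ c) (ℕP.+-comm t 4) t+4≤3+c)))

module Escalation {c n : ℕ} (a : Fin n → ℕ) (pos : ∀ l → 0 < a l)
  (sorted : ∀ k l → toℕ k ≤ toℕ l → a k ≤ a l)
  (small : ∀ t → 1 ≤ t → t ℕ.+ 4 ≤ 3 ℕ.+ c → Represents (3 ℕ.+ c) a (+ t))
  (N : ℤ) where

  CoveredByPrefix : ℕ → Set
  CoveredByPrefix k = ∀ j → j ≤ prefixSum a k →
    ∃ λ x → VanishesFrom k x × F (3 ℕ.+ c) a x ≡ N + + j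

  coveredByPrefix-firstCoeffs : ∀ {i} (i≤n : i ≤ n) →
    (∀ j → j ≤ coeffSum (firstCoeffs i i≤n a) → Represents (3 ℕ.+ c) (firstCoeffs i i≤n a) (N + + j)) →
    CoveredByPrefix i
  coveredByPrefix-firstCoeffs i≤n first j j≤T
    with first j (subst (j ≤_) (sym (coeffSum-firstCoeffs i≤n a)) j≤T)
  ... | y , Fy = extendByZero i≤n y , extendByZero-vanishes i≤n y ,
                 trans (F-extendByZero (3 ℕ.+ c) i≤n a y) Fy

  coveredByPrefix-suc : ∀ {k} (k<n : k < n) → a (fromℕ< k<n) ≤ suc (prefixSum a k) →
                        CoveredByPrefix k → CoveredByPrefix (suc k)
  coveredByPrefix-suc {k} k<n aₚ≤1+T covered j j≤T' with j ≤? prefixSum a k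
  ... | yes j≤T with covered j j≤T
  ...   | x , x-vanishes , Fx = x , (λ l k<l → x-vanishes l (ℕP.<⇒≤ k<l)) , Fx
  coveredByPrefix-suc {k} k<n aₚ≤1+T covered j j≤T' | no j≰T
    with covered (j ∸ a p) j∸aₚ≤T
    where
    p : Fin n
    p = fromℕ< k<n
    j≤T+aₚ : j ≤ prefixSum a k ℕ.+ a p
    j≤T+aₚ = subst (j ≤_) (prefixSum-suc a k<n) j≤T'
    j∸aₚ≤T : j ∸ a p ≤ prefixSum a k
    j∸aₚ≤T = ℕP.≤-trans (ℕP.∸-monoˡ-≤ (a p) j≤T+aₚ) (ℕP.≤-reflexive (ℕP.m+n∸n≡m _ (a p)))
  ... | x , x-vanishes , Fx = updateAt x p (const (+ 1)) , x'-vanishes , (begin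
      F (3 ℕ.+ c) a (updateAt x p (const (+ 1)))  ≡⟨ F-updateAt-0↦1 (3 ℕ.+ c) a x p xₚ≡0 ⟩
      F (3 ℕ.+ c) a x + + a p                     ≡⟨ cong (_+ + a p) Fx ⟩
      N + + (j ∸ a p) + + a p                     ≡⟨ ℤP.+-assoc N (+ (j ∸ a p)) (+ a p) ⟩
      N + (+ (j ∸ a p) + + a p)                   ≡⟨ cong (_+_ N) (ℤP.pos-+ (j ∸ a p) (a p)) ⟨
      N + + (j ∸ a p ℕ.+ a p)                     ≡⟨ cong (λ z → N + + z) (ℕP.m∸n+n≡m aₚ≤j) ⟩
      N + + j                                     ∎)
    where
    p : Fin n
    p = fromℕ< k<n
    toℕp≡k : toℕ p ≡ k
    toℕp≡k = toℕ-fromℕ< k<n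
    aₚ≤j : a p ≤ j
    aₚ≤j = ℕP.≤-trans aₚ≤1+T (ℕP.≰⇒> j≰T)
    xₚ≡0 : x p ≡ + 0
    xₚ≡0 = x-vanishes p (ℕP.≤-reflexive (sym toℕp≡k))
    x'-vanishes : VanishesFrom (suc k) (updateAt x p (const (+ 1)))
    x'-vanishes l k<l = trans (updateAt-minimal l p x l≢p) (x-vanishes l (ℕP.<⇒≤ k<l))
      where
      l≢p : l ≢ p
      l≢p l≡p = ℕP.<-irrefl (sym (trans (cong toℕ l≡p) toℕp≡k)) k<l

  ¬laterCoeffs>1+prefixSum : ∀ k {j} → j ≰ prefixSum a k → j ℕ.+ 4 ≤ 3 ℕ.+ c →
                             ¬ (∀ l → k ≤ toℕ l → suc (prefixSum a k) < a l)
  ¬laterCoeffs>1+prefixSum k j≰T j+4≤m later>1+T =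
    let x , Fx = small (suc (prefixSum a k)) (s≤s z≤n) 1+T+4≤m
    in ℕP.1+n≰n (small-value≤prefixSum c a pos x Fx (t+4≤3+c⇒t<c 1+T+4≤m) later>1+T)
    where
    1+T+4≤m : suc (prefixSum a k) ℕ.+ 4 ≤ 3 ℕ.+ c
    1+T+4≤m = ℕP.≤-trans (ℕP.+-monoˡ-≤ 4 (ℕP.≰⇒> j≰T)) j+4≤m

  coveredByPrefix⇒represents : ∀ r k → r ℕ.+ k ≡ n → CoveredByPrefix k →
                               ∀ j → j ℕ.+ 4 ≤ 3 ℕ.+ c → Represents (3 ℕ.+ c) a (N + + j)
  coveredByPrefix⇒represents r k r+k≡n covered j j+4≤m with j ≤? prefixSum a k
  ... | yes j≤T with covered j j≤T
  ...   | x , _ , Fx = x , Fx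
  coveredByPrefix⇒represents zero k refl covered j j+4≤m | no j≰T =
    ⊥-elim (¬laterCoeffs>1+prefixSum k j≰T j+4≤m λ l k≤l → contradiction (toℕ<n l) (ℕP.≤⇒≯ k≤l))
  coveredByPrefix⇒represents (suc r) k r+k≡n covered j j+4≤m | no j≰T =
    continue (a (fromℕ< k<n) ≤? suc (prefixSum a k))
    where
    k<n : k < n
    k<n = subst (k <_) r+k≡n (s≤s (ℕP.m≤n+m k r))
    continue : Dec (a (fromℕ< k<n) ≤ suc (prefixSum a k)) → Represents (3 ℕ.+ c) a (N + + j)
    continue (yes aₖ≤1+T) = coveredByPrefix⇒represents r (suc k) (trans (ℕP.+-suc r k) r+k≡n)
                              (coveredByPrefix-suc k<n aₖ≤1+T covered) j j+4≤m
    continue (no aₖ≰1+T) = ⊥-elim (¬laterCoeffs>1+prefixSum k j≰T j+4≤m λ l k≤l →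
      ℕP.<-≤-trans (ℕP.≰⇒> aₖ≰1+T) (sorted _ l (subst (_≤ toℕ l) (sym (toℕ-fromℕ< k<n)) k≤l)))

proposition3p1 : (m n : ℕ) → 3 ≤ m → (a : Fin n → ℕ) →
    (∀ k → 0 < a k) → (∀ k l → toℕ k ≤ toℕ l → a k ≤ a l) →
    (∀ (t : ℕ) → 1 ≤ t → t ℕ.+ 4 ≤ m → Represents m a (+ t)) →
    (i : ℕ) → 1 ≤ i → (i≤n : i ≤ n) → (N : ℤ) →
    (∀ (j : ℕ) → j ≤ coeffSum (firstCoeffs i i≤n a) → Represents m (firstCoeffs i i≤n a) (N + + j)) →
    ∀ (j : ℕ) → j ℕ.+ 4 ≤ m → Represents m a (N + + j)
proposition3p1 (suc (suc (suc c))) n (s≤s (s≤s (s≤s z≤n))) a pos sorted small i _ i≤n N first =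
  coveredByPrefix⇒represents (n ∸ i) i (ℕP.m∸n+n≡m i≤n) (coveredByPrefix-firstCoeffs i≤n first)
  where open Escalation a pos sorted small N
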